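{- Let $P_5$ be the undirected path on the five vertices $\texttt{2},\texttt{0},\texttt{1},\hat{\texttt{2}},\hat{\texttt{0}}$ in this order (edges $\texttt{2}\texttt{0}$, $\texttt{0}\texttt{1}$, $\texttt{1}\hat{\texttt{2}}$, $\hat{\texttt{2}}\hat{\texttt{0}}$). Let $k_5$ be the morphism $\texttt{0}\mapsto \texttt{0}\texttt{1}\hat{\texttt{2}}\hat{\texttt{0}}\hat{\texttt{2}}\texttt{1}$, $\texttt{1}\mapsto\texttt{0}\texttt{1}\hat{\texttt{2}}\texttt{1}$, $\texttt{2}\mapsto\texttt{0}\texttt{2}$. Every bi-infinite square-free walk on $P_5$ has the same set of finite factors as $k_5(b_3)$.
   Context: A walk on a graph $G$ is a (finite, infinite or bi-infinite) word over the vertex set of $G$ such that any two consecutive letters are adjacent in $G$. A word is square-free if it contains no factor of the form $uu$ with $u$ nonempty. $b_3$ is the Hall–Thue word, the fixed point starting with $\texttt{0}$ of the morphism $\texttt{0}\mapsto\texttt{012}$, $\texttt{1}\mapsto\texttt{02}$, $\texttt{2}\mapsto\texttt{1}$. -}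

module Defs where

open import Data.Nat using (ℕ; zero; suc; _<_)
open import Data.Integer using (ℤ; +_) renaming (_+_ to _+ℤ_)
open import Data.Fin using (Fin; zero; suc)
open import Data.List using (List; []; _∷_; _++_; map; concatMap; length; upTo)
open import Data.Product using (∃; ∃-syntax; _×_)
open import Relation.Binary.PropositionalEquality using (_≡_; _≢_)
open import Function using (_⇔_)

window : {A : Set} → (ℤ → A) → ℤ → ℕ → List A
window x i n = map (λ j → x (i +ℤ + j)) (upTo n)

IsFactorOfList : {A : Set} → List A → List A → Set
IsFactorOfList u v = ∃[ p ] ∃[ s ] (p ++ u ++ s ≡ v)

IsFactorBi : {A : Set} → List A → (ℤ → A) → Set
IsFactorBi u x = ∃[ i ] (window x i (length u) ≡ u)

prefix : {A : Set} → (ℕ → A) → ℕ → List A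
prefix x n = map x (upTo n)

IsFactorOfImage : {A B : Set} → List B → (A → List B) → (ℕ → A) → Set
IsFactorOfImage u f x = ∃[ n ] IsFactorOfList u (concatMap f (prefix x n))

SquareFreeBi : {A : Set} → (ℤ → A) → Set
SquareFreeBi x = ∀ (i : ℤ) (n : ℕ) → 0 < n →
  window x i n ≢ window x (i +ℤ + n) n

h3 : Fin 3 → List (Fin 3)
h3 zero = zero ∷ suc zero ∷ suc (suc zero) ∷ []
h3 (suc zero) = zero ∷ suc (suc zero) ∷ []
h3 (suc (suc zero)) = suc zero ∷ []

h3-iter : ℕ → List (Fin 3)
h3-iter zero = zero ∷ []
h3-iter (suc n) = concatMap h3 (h3-iter n)

nth : {A : Set} → A → List A → ℕ → A
nth d [] _ = d
nth d (a ∷ as) zero = a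
nth d (a ∷ as) (suc k) = nth d as k

-- b₃(i) is the i-th letter of h3^(i+1)(0), which has length > i and is a
-- prefix of the fixed point starting with 0 (the default is never used).
b3 : ℕ → Fin 3
b3 i = nth zero (h3-iter (suc i)) i

data V5 : Set where
  v2 v0 v1 v2h v0h : V5

data Adj5 : V5 → V5 → Set where
  e20 : Adj5 v2 v0
  e02 : Adj5 v0 v2
  e01 : Adj5 v0 v1
  e10 : Adj5 v1 v0
  e12h : Adj5 v1 v2h
  e2h1 : Adj5 v2h v1
  e2h0h : Adj5 v2h v0h
  e0h2h : Adj5 v0h v2h

IsWalkBi : (ℤ → V5) → Set
IsWalkBi x = ∀ (i : ℤ) → Adj5 (x i) (x (i +ℤ + 1))

k5 : Fin 3 → List V5
k5 zero = v0 ∷ v1 ∷ v2h ∷ v0h ∷ v2h ∷ v1 ∷ []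
k5 (suc zero) = v0 ∷ v1 ∷ v2h ∷ v1 ∷ []
k5 (suc (suc zero)) = v0 ∷ v2 ∷ []

{-# OPTIONS --safe #-}
-- A square-free walk on P₅ is rigid: away from its left end, every 0 begins one of the
-- blocks k₅(0), k₅(1), k₅(2), which is followed by another 0, and 0 occurs among any
-- eight consecutive letters.  So the walk is k₅(y) for a ternary word y, which is again
-- square-free and avoids 010 and 212.  Such a Thue word is in turn h₃(y′) for a Thue
-- word y′, where h₃ is the Hall–Thue morphism.  Iterating this desubstitution shows that
-- every h₃ⁿ(0) occurs in y, hence every factor of k₅(b₃) occurs in the walk.  Conversely,
-- desubstituting twice at least halves lengths, so by induction on the length every factor
-- of a Thue word far enough from its start is a factor of some h₃ⁿ(0), that is, of b₃; a
-- factor of the bi-infinite walk is reached by parsing from far enough to the left.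
module Submission where

open import Defs
open import Data.Bool using (Bool; false; T; _∨_)
open import Data.Bool.ListAction using (all; any)
open import Data.Bool.Properties using (T-∨)
open import Data.Empty using (⊥-elim)
open import Data.Fin using (Fin; zero; suc)
open import Data.Fin.Properties using (any?) renaming (_≟_ to _≟F_)
open import Data.Integer using (ℤ; _-_; -_; 0ℤ) renaming (_+_ to _+ℤ_)
import Data.Integer as ℤ using (+_)
import Data.Integer.Properties as ℤ
open import Data.List using (List; []; _∷_; _++_; _∷ʳ_; length; take; drop; map; concatMap; upTo; applyUpTo; allFin)
open import Data.List.Properties
  using (length-++; ++-assoc; ++-identityʳ; ∷-injective; ∷-injectiveˡ; concatMap-++; ≡-dec; take++drop≡id; map-applyUpTo)
open import Data.List.Membership.Propositional using (_∈_; lose)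
open import Data.List.Membership.Propositional.Properties using (∈-concatMap⁺; ∈-map⁺; ∈-allFin)
import Data.List.Membership.DecPropositional as DecMembership
open import Data.List.Relation.Unary.All as All using ()
open import Data.List.Relation.Unary.All.Properties using (all⁺)
open import Data.List.Relation.Unary.Any using (here; there; satisfied)
open import Data.List.Relation.Unary.Any.Properties using (any⁻)
open import Data.Nat using (ℕ; zero; suc; _+_; _*_; _∸_; _≤_; _<_; z≤n; s≤s; ⌊_/2⌋)
open import Data.Nat.Induction using (<-rec)
open import Data.Nat.Properties
open import Data.Product using (Σ; _×_; _,_; proj₁; proj₂; ∃-syntax)
open import Data.Sum using (_⊎_; inj₁; inj₂)
open import Data.Unit using (⊤; tt)
open import Function using (_∘_; _⇔_; mk⇔; mk↣; Equivalence)
open import Relation.Binary.Definitions using (DecidableEquality)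
open import Relation.Binary.PropositionalEquality
open import Relation.Nullary using (¬_; Dec; yes; no; _×-dec_; _→-dec_; ¬?)
open import Relation.Nullary.Decidable using (isYes; toWitness)
open import Relation.Unary using (Decidable)

private variable
  A B C : Set

-- Factors and squares of one-sided words

++-cancel-length : ∀ (p q : List A) {r s} → length p ≡ length q → p ++ r ≡ q ++ s → p ≡ q × r ≡ s
++-cancel-length [] [] _ eq = refl , eq
++-cancel-length (a ∷ p) (b ∷ q) len eq with ∷-injective eq
... | refl , eq′ with ++-cancel-length p q (suc-injective len) eq′
... | refl , r≡s = refl , r≡s

slice : (ℕ → A) → ℕ → ℕ → List A
slice z i zero = []
slice z i (suc n) = z i ∷ slice z (suc i) n

length-slice : ∀ (z : ℕ → A) i n → length (slice z i n) ≡ n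
length-slice z i zero = refl
length-slice z i (suc n) = cong suc (length-slice z (suc i) n)

slice-suc : ∀ (z : ℕ → A) j n → slice (λ i → z (suc i)) j n ≡ slice z (suc j) n
slice-suc z j zero = refl
slice-suc z j (suc n) = cong (z (suc j) ∷_) (slice-suc z (suc j) n)

applyUpTo-slice : ∀ (f : ℕ → A) n → applyUpTo f n ≡ slice f 0 n
applyUpTo-slice f zero = refl
applyUpTo-slice f (suc n) = cong (f 0 ∷_) (trans (applyUpTo-slice (λ i → f (suc i)) n) (slice-suc f 0 n))

map-upTo-slice : ∀ (f : ℕ → A) n → map f (upTo n) ≡ slice f 0 n
map-upTo-slice f n = trans (map-applyUpTo (λ i → i) f n) (applyUpTo-slice f n)

slice-nth : ∀ (z : ℕ → A) d j (l : List A) → (∀ i → i < length l → z (j + i) ≡ nth d l i) →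
  slice z j (length l) ≡ l
slice-nth z d j [] _ = refl
slice-nth z d j (a ∷ l) agree = cong₂ _∷_ (trans (cong z (sym (+-identityʳ j))) (agree 0 (s≤s z≤n)))
  (slice-nth z d (suc j) l λ i i<|l| → trans (cong z (sym (+-suc j i))) (agree (suc i) (s≤s i<|l|)))

∈-slice : ∀ {a} (z : ℕ → A) j n → a ∈ slice z j n → ∃[ i ] i < n × z (j + i) ≡ a
∈-slice z j (suc n) (here eq) = 0 , s≤s z≤n , trans (cong z (+-identityʳ j)) (sym eq)
∈-slice z j (suc n) (there a∈) with ∈-slice z (suc j) n a∈
... | i , i<n , eq = suc i , s≤s i<n , trans (cong z (+-suc j i)) eq

slice-cong : ∀ {z w : ℕ → A} {i j} n → (∀ t → z (i + t) ≡ w (j + t)) → slice z i n ≡ slice w j n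
slice-cong zero _ = refl
slice-cong {z = z} {w} {i} {j} (suc n) eq = cong₂ _∷_ head (slice-cong n tail)
  where
  head : z i ≡ w j
  head = subst₂ (λ a b → z a ≡ w b) (+-identityʳ i) (+-identityʳ j) (eq 0)
  tail : ∀ t → z (suc i + t) ≡ w (suc j + t)
  tail t = subst₂ (λ a b → z a ≡ w b) (+-suc i t) (+-suc j t) (eq (suc t))

slice-+ : ∀ (z : ℕ → A) i m n → slice z i (m + n) ≡ slice z i m ++ slice z (i + m) n
slice-+ z i zero n = cong (λ k → slice z k n) (sym (+-identityʳ i))
slice-+ z i (suc m) n = cong (z i ∷_) (trans (slice-+ z (suc i) m n)
  (cong (λ k → slice z (suc i) m ++ slice z k n) (sym (+-suc i m))))

take-slice : ∀ (z : ℕ → A) i {m n} → m ≤ n → take m (slice z i n) ≡ slice z i m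
take-slice z i z≤n = refl
take-slice z i (s≤s m≤n) = cong (z i ∷_) (take-slice z (suc i) m≤n)

slice-infix : ∀ (z : ℕ → A) i n (p u s : List A) → slice z i n ≡ p ++ u ++ s →
  slice z (i + length p) (length u) ≡ u
slice-infix z i n p u s eq = proj₁ (++-cancel-length (slice z j (length u)) u (length-slice z j _) middle)
  where
  j = i + length p
  n≡ : n ≡ length p + (length u + length s)
  n≡ = trans (sym (length-slice z i n)) (trans (cong length eq) (trans (length-++ p) (cong (length p +_) (length-++ u))))
  split : slice z i n ≡ slice z i (length p) ++ slice z j (length u) ++ slice z (j + length u) (length s)
  split = begin
    slice z i n                                             ≡⟨ cong (slice z i) n≡ ⟩
    slice z i (length p + (length u + length s))            ≡⟨ slice-+ z i (length p) _ ⟩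
    slice z i (length p) ++ slice z j (length u + length s)
      ≡⟨ cong (slice z i (length p) ++_) (slice-+ z j (length u) (length s)) ⟩
    slice z i (length p) ++ slice z j (length u) ++ slice z (j + length u) (length s) ∎
    where open ≡-Reasoning
  middle : slice z j (length u) ++ slice z (j + length u) (length s) ≡ u ++ s
  middle = proj₂ (++-cancel-length (slice z i (length p)) p (length-slice z i _) (trans (sym split) eq))

slice-factor : ∀ (z : ℕ → A) {i d} m n → i ≤ d → d + m ≤ i + n → IsFactorOfList (slice z d m) (slice z i n)
slice-factor z {i} {d} m n i≤d d+m≤i+n = slice z i a , slice z (d + m) c , sym split
  where
  a = d ∸ i
  c = n ∸ (a + m)
  i+a≡d : i + a ≡ d
  i+a≡d = m+[n∸m]≡n i≤d
  a+m≤n : a + m ≤ n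
  a+m≤n = +-cancelˡ-≤ i (a + m) n (subst (_≤ i + n) (trans (cong (_+ m) (sym i+a≡d)) (+-assoc i a m)) d+m≤i+n)
  split : slice z i n ≡ slice z i a ++ slice z d m ++ slice z (d + m) c
  split = begin
    slice z i n                             ≡⟨ cong (slice z i) (trans (sym (m+[n∸m]≡n a+m≤n)) (+-assoc a m c)) ⟩
    slice z i (a + (m + c))                 ≡⟨ slice-+ z i a (m + c) ⟩
    slice z i a ++ slice z (i + a) (m + c)  ≡⟨ cong (λ k → slice z i a ++ slice z k (m + c)) i+a≡d ⟩
    slice z i a ++ slice z d (m + c)        ≡⟨ cong (slice z i a ++_) (slice-+ z d m c) ⟩
    slice z i a ++ slice z d m ++ slice z (d + m) c ∎
    where open ≡-Reasoning

factor-trans : {u v w : List A} → IsFactorOfList u v → IsFactorOfList v w → IsFactorOfList u w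
factor-trans {u = u} (p , s , refl) (p′ , s′ , refl) = p′ ++ p , s ++ s′ , (begin
  (p′ ++ p) ++ u ++ s ++ s′   ≡⟨ ++-assoc p′ p _ ⟩
  p′ ++ p ++ u ++ s ++ s′     ≡⟨ cong (λ t → p′ ++ p ++ t) (sym (++-assoc u s s′)) ⟩
  p′ ++ p ++ (u ++ s) ++ s′   ≡⟨ cong (p′ ++_) (sym (++-assoc p (u ++ s) s′)) ⟩
  p′ ++ (p ++ u ++ s) ++ s′   ∎)
  where open ≡-Reasoning

factor-concatMap : (f : A → List B) {u v : List A} →
  IsFactorOfList u v → IsFactorOfList (concatMap f u) (concatMap f v)
factor-concatMap f {u} (p , s , refl) = concatMap f p , concatMap f s , (begin
  concatMap f p ++ concatMap f u ++ concatMap f s ≡⟨ cong (concatMap f p ++_) (sym (concatMap-++ f u s)) ⟩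
  concatMap f p ++ concatMap f (u ++ s)           ≡⟨ sym (concatMap-++ f p (u ++ s)) ⟩
  concatMap f (p ++ u ++ s)                       ∎)
  where open ≡-Reasoning

concatMap-∘ : (f : B → List C) (g : A → List B) (w : List A) →
  concatMap (concatMap f ∘ g) w ≡ concatMap f (concatMap g w)
concatMap-∘ f g [] = refl
concatMap-∘ f g (a ∷ w) =
  trans (cong (concatMap f (g a) ++_) (concatMap-∘ f g w)) (sym (concatMap-++ f (g a) (concatMap g w)))

SquareFree : (ℕ → A) → Set
SquareFree z = ∀ i n → 0 < n → slice z i n ≢ slice z (i + n) n

HasSquare : List A → Set
HasSquare w = ∃[ u ] 0 < length u × IsFactorOfList (u ++ u) w

module _ (_≟_ : DecidableEquality A) where

  squarePrefix : ℕ → List A → Bool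
  squarePrefix l w = isYes (≡-dec _≟_ (take (suc l) w) (take (suc l) (drop (suc l) w)))

  hasSquare : List A → Bool
  hasSquare [] = false
  hasSquare (a ∷ w) = any (λ l → squarePrefix l (a ∷ w)) (upTo (length w)) ∨ hasSquare w

  squarePrefix-sound : ∀ l a w → T (squarePrefix l (a ∷ w)) → HasSquare (a ∷ w)
  squarePrefix-sound l a w t = u , s≤s z≤n , [] , drop (suc l) rest , (begin
    (u ++ u) ++ drop (suc l) rest            ≡⟨ ++-assoc u u _ ⟩
    u ++ u ++ drop (suc l) rest              ≡⟨ cong (λ v → u ++ v ++ drop (suc l) rest) (toWitness t) ⟩
    u ++ take (suc l) rest ++ drop (suc l) rest ≡⟨ cong (u ++_) (take++drop≡id (suc l) rest) ⟩
    u ++ rest                                ≡⟨ take++drop≡id (suc l) (a ∷ w) ⟩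
    a ∷ w                                    ∎)
    where
    open ≡-Reasoning
    u = take (suc l) (a ∷ w)
    rest = drop (suc l) (a ∷ w)

  hasSquare-sound : ∀ w → T (hasSquare w) → HasSquare w
  hasSquare-sound (a ∷ w) t with Equivalence.to T-∨ t
  ... | inj₁ prefix =
    let l , square = satisfied (any⁻ (λ l → squarePrefix l (a ∷ w)) (upTo (length w)) prefix)
    in squarePrefix-sound l a w square
  ... | inj₂ later =
    let u , 0<|u| , p , s , eq = hasSquare-sound w later
    in u , 0<|u| , a ∷ p , s , cong (a ∷_) eq

squareFree⇒¬HasSquare : {z : ℕ → A} → SquareFree z → ∀ j n → ¬ HasSquare (slice z j n)
squareFree⇒¬HasSquare {z = z} sq j n (u , 0<|u| , p , s , eq) =
  sq i (length u) 0<|u| (trans (proj₁ halves) (sym (proj₂ halves)))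
  where
  i = j + length p
  uu : slice z i (length u + length u) ≡ u ++ u
  uu = trans (cong (slice z i) (sym (length-++ u))) (slice-infix z j n p (u ++ u) s (sym eq))
  halves : slice z i (length u) ≡ u × slice z (i + length u) (length u) ≡ u
  halves = ++-cancel-length _ u (length-slice z i _) (trans (sym (slice-+ z i (length u) (length u))) uu)

module _ (letters : List A) (next : A → List A) where

  walksFrom : ℕ → A → List (List A)
  walksFrom zero a = (a ∷ []) ∷ []
  walksFrom (suc n) a = concatMap (λ b → map (a ∷_) (walksFrom n b)) (next a)

  walks : ℕ → List (List A)
  walks n = concatMap (walksFrom n) letters

  all-slices : (p : List A → Bool) {z : ℕ → A} → (∀ i → z i ∈ letters) → (∀ i → z (suc i) ∈ next (z i)) →
    ∀ n → T (all p (walks n)) → ∀ j → T (p (slice z j (suc n)))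
  all-slices p {z} letter step n all-p j =
    All.lookup (all⁺ p (walks n) all-p) (∈-concatMap⁺ (walksFrom n) (lose (letter j) (slice-∈-walksFrom n j)))
    where
    slice-∈-walksFrom : ∀ n j → slice z j (suc n) ∈ walksFrom n (z j)
    slice-∈-walksFrom zero j = here refl
    slice-∈-walksFrom (suc n) j = ∈-concatMap⁺ _ (lose (step j) (∈-map⁺ (z j ∷_) (slice-∈-walksFrom n (suc j))))

-- Parsing a word as the image of a morphism

record Parse (f : A → List B) (x : ℕ → B) (y : ℕ → A) (pos : ℕ → ℕ) : Set where
  field
    pos-suc : ∀ k → pos (suc k) ≡ pos k + length (f (y k))
    block   : ∀ k → slice x (pos k) (length (f (y k))) ≡ f (y k)
open Parse public

Parse-tail : {f : A → List B} {x : ℕ → B} {y : ℕ → A} {pos : ℕ → ℕ} →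
  Parse f x y pos → Parse f x (y ∘ suc) (pos ∘ suc)
Parse-tail P = record { pos-suc = pos-suc P ∘ suc ; block = block P ∘ suc }

Parse-unfold : (f : A → List B) (x : ℕ → B) (S : ℕ → Set) →
  (∀ p → S p → Σ A λ a → slice x p (length (f a)) ≡ f a × S (p + length (f a))) →
  ∀ p → S p → Σ (ℕ → A) λ y → Σ (ℕ → ℕ) λ pos → Parse f x y pos × pos 0 ≡ p
Parse-unfold {A = A} f x S step p sp = letter , position , record { pos-suc = λ _ → refl ; block = block′ } , refl
  where
  state : ℕ → Σ ℕ S
  state zero = p , sp
  state (suc k) = let (q , sq) = state k ; (a , _ , sq′) = step q sq in q + length (f a) , sq′
  letter : ℕ → A
  letter k = proj₁ (step (proj₁ (state k)) (proj₂ (state k)))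
  position : ℕ → ℕ
  position k = proj₁ (state k)
  block′ : ∀ k → slice x (position k) (length (f (letter k))) ≡ f (letter k)
  block′ k = proj₁ (proj₂ (step (proj₁ (state k)) (proj₂ (state k))))

module _ {f : A → List B} {x : ℕ → B} {y : ℕ → A} {pos : ℕ → ℕ} (P : Parse f x y pos) where

  pos-+ : ∀ k m → pos (k + m) ≡ pos k + length (concatMap f (slice y k m))
  pos-+ k zero = trans (cong pos (+-identityʳ k)) (sym (+-identityʳ (pos k)))
  pos-+ k (suc m) = begin
    pos (k + suc m)                                ≡⟨ cong pos (+-suc k m) ⟩
    pos (suc k + m)                                ≡⟨ pos-+ (suc k) m ⟩
    pos (suc k) + length W                         ≡⟨ cong (_+ length W) (pos-suc P k) ⟩
    pos k + length (f (y k)) + length W            ≡⟨ +-assoc (pos k) _ _ ⟩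
    pos k + (length (f (y k)) + length W)          ≡⟨ cong (pos k +_) (length-++ (f (y k))) ⟨
    pos k + length (f (y k) ++ W)                  ∎
    where
    open ≡-Reasoning
    W = concatMap f (slice y (suc k) m)

  slice-concatMap : ∀ k m → slice x (pos k) (length (concatMap f (slice y k m))) ≡ concatMap f (slice y k m)
  slice-concatMap k zero = refl
  slice-concatMap k (suc m) = begin
    slice x (pos k) (length (f (y k) ++ W))                       ≡⟨ cong (slice x (pos k)) (length-++ (f (y k))) ⟩
    slice x (pos k) (length (f (y k)) + length W)                 ≡⟨ slice-+ x (pos k) (length (f (y k))) (length W) ⟩
    slice x (pos k) (length (f (y k))) ++ slice x (pos k + length (f (y k))) (length W)
      ≡⟨ cong₂ _++_ (block P k) (cong (λ q → slice x q (length W)) (sym (pos-suc P k))) ⟩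
    f (y k) ++ slice x (pos (suc k)) (length W)                   ≡⟨ cong (f (y k) ++_) (slice-concatMap (suc k) m) ⟩
    f (y k) ++ W                                                   ∎
    where
    open ≡-Reasoning
    W = concatMap f (slice y (suc k) m)

  squareFree-preimage : (∀ a → 0 < length (f a)) → SquareFree x → SquareFree y
  squareFree-preimage nonempty sqx j (suc n) _ eq =
    sqx (pos j) (length W) 0<|W| (begin
      slice x (pos j) (length W)                  ≡⟨ slice-concatMap j (suc n) ⟩
      W                                           ≡⟨ cong (concatMap f) eq ⟩
      W′                                          ≡⟨ slice-concatMap (j + suc n) (suc n) ⟨
      slice x (pos (j + suc n)) (length W′)
        ≡⟨ cong₂ (slice x) (pos-+ j (suc n)) (cong (length ∘ concatMap f) (sym eq)) ⟩
      slice x (pos j + length W) (length W)       ∎)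
    where
    open ≡-Reasoning
    W  = concatMap f (slice y j (suc n))
    W′ = concatMap f (slice y (j + suc n) (suc n))
    0<|W| : 0 < length W
    0<|W| = ≤-trans (nonempty (y j)) (subst (length (f (y j)) ≤_) (sym (length-++ (f (y j)))) (m≤m+n _ _))

  pos-lower : ∀ {lo} → (∀ a → lo ≤ length (f a)) → ∀ n k → n * lo + pos k ≤ pos (n + k)
  pos-lower _ zero k = ≤-refl
  pos-lower {lo} long (suc n) k = begin
    lo + n * lo + pos k                 ≡⟨ +-assoc lo (n * lo) (pos k) ⟩
    lo + (n * lo + pos k)               ≤⟨ +-monoʳ-≤ lo (pos-lower long n k) ⟩
    lo + pos (n + k)                    ≤⟨ +-monoˡ-≤ (pos (n + k)) (long (y (n + k))) ⟩
    length (f (y (n + k))) + pos (n + k) ≡⟨ +-comm _ (pos (n + k)) ⟩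
    pos (n + k) + length (f (y (n + k))) ≡⟨ pos-suc P (n + k) ⟨
    pos (suc n + k)                     ∎
    where open ≤-Reasoning

  pos-upper : ∀ {hi} → (∀ a → length (f a) ≤ hi) → ∀ n k → pos (n + k) ≤ n * hi + pos k
  pos-upper _ zero k = ≤-refl
  pos-upper {hi} short (suc n) k = begin
    pos (suc n + k)                      ≡⟨ pos-suc P (n + k) ⟩
    pos (n + k) + length (f (y (n + k))) ≡⟨ +-comm (pos (n + k)) _ ⟩
    length (f (y (n + k))) + pos (n + k) ≤⟨ +-mono-≤ (short (y (n + k))) (pos-upper short n k) ⟩
    hi + (n * hi + pos k)                ≡⟨ +-assoc hi (n * hi) (pos k) ⟨
    hi + n * hi + pos k                  ∎
    where open ≤-Reasoning

  pos-cover : (∀ a → 0 < length (f a)) → ∀ n → ∃[ k ] pos k ≤ pos 0 + n × pos 0 + n < pos (suc k)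
  pos-cover nonempty zero = 0 , m≤m+n (pos 0) 0 , (begin-strict
    pos 0 + 0                  <⟨ +-monoʳ-< (pos 0) (nonempty (y 0)) ⟩
    pos 0 + length (f (y 0))   ≡⟨ pos-suc P 0 ⟨
    pos 1                      ∎)
    where open ≤-Reasoning
  pos-cover nonempty (suc n) with pos-cover nonempty n
  ... | k , pk≤ , <pk+1 with pos 0 + suc n <? pos (suc k)
  ...   | yes <pk+1′ = k , ≤-trans pk≤ (+-monoʳ-≤ (pos 0) (n≤1+n n)) , <pk+1′
  ...   | no ≮pk+1 = suc k , ≤-reflexive pk+1≡ , (begin-strict
    pos 0 + suc n                      ≡⟨ pk+1≡ ⟨
    pos (suc k)                        <⟨ m<m+n (pos (suc k)) (nonempty (y (suc k))) ⟩
    pos (suc k) + length (f (y (suc k))) ≡⟨ pos-suc P (suc k) ⟨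
    pos (suc (suc k))                  ∎)
    where
    open ≤-Reasoning
    pk+1≡ : pos (suc k) ≡ pos 0 + suc n
    pk+1≡ = ≤-antisym (≮⇒≥ ≮pk+1) (subst (_≤ pos (suc k)) (sym (+-suc (pos 0) n)) <pk+1)

  slice-in-image : ∀ {lo hi} → 0 < lo → (∀ a → lo ≤ length (f a)) → (∀ a → length (f a) ≤ hi) →
    ∀ J d m t → pos 0 + J * hi ≤ d → m ≤ suc (t * lo) →
    ∃[ k ] J ≤ k × IsFactorOfList (slice x d m) (concatMap f (slice y k (suc t)))
  slice-in-image {lo} {hi} 0<lo long short J d m t far m≤ = k , J≤k ,
    subst (IsFactorOfList (slice x d m)) (slice-concatMap k (suc t))
      (slice-factor x m (length (concatMap f (slice y k (suc t)))) pk≤d end)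
    where
    pos0≤d = ≤-trans (m≤m+n (pos 0) (J * hi)) far
    cover = subst (λ e → ∃[ k ] pos k ≤ e × e < pos (suc k)) (m+[n∸m]≡n pos0≤d)
              (pos-cover (λ a → ≤-trans 0<lo (long a)) (d ∸ pos 0))
    k = proj₁ cover
    pk≤d = proj₁ (proj₂ cover)
    d<pk+1 = proj₂ (proj₂ cover)
    J≤k : J ≤ k
    J≤k = ≮⇒≥ λ k<J → <-irrefl refl (begin-strict
      d                      <⟨ d<pk+1 ⟩
      pos (suc k)            ≡⟨ cong pos (+-identityʳ (suc k)) ⟨
      pos (suc k + 0)        ≤⟨ pos-upper short (suc k) 0 ⟩
      suc k * hi + pos 0     ≡⟨ +-comm (suc k * hi) (pos 0) ⟩
      pos 0 + suc k * hi     ≤⟨ +-monoʳ-≤ (pos 0) (*-monoˡ-≤ hi k<J) ⟩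
      pos 0 + J * hi         ≤⟨ far ⟩
      d                      ∎)
      where open ≤-Reasoning
    end : d + m ≤ pos k + length (concatMap f (slice y k (suc t)))
    end = begin
      d + m                  ≤⟨ +-monoʳ-≤ d m≤ ⟩
      d + suc (t * lo)       ≡⟨ +-suc d (t * lo) ⟩
      suc d + t * lo         ≤⟨ +-monoˡ-≤ (t * lo) d<pk+1 ⟩
      pos (suc k) + t * lo   ≡⟨ +-comm (pos (suc k)) (t * lo) ⟩
      t * lo + pos (suc k)   ≤⟨ pos-lower long t (suc k) ⟩
      pos (t + suc k)        ≡⟨ cong pos (trans (+-suc t k) (cong suc (+-comm t k))) ⟩
      pos (suc (k + t))      ≡⟨ cong pos (+-suc k t) ⟨
      pos (k + suc t)        ≡⟨ pos-+ k (suc t) ⟩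
      pos k + length (concatMap f (slice y k (suc t))) ∎
      where open ≤-Reasoning

Parse-∘ : {f : A → List B} {g : C → List A} {x : ℕ → B} {y : ℕ → A} {w : ℕ → C}
  {pos pos′ : ℕ → ℕ} →
  Parse f x y pos → Parse g y w pos′ → Parse (concatMap f ∘ g) x w (pos ∘ pos′)
Parse-∘ {f = f} {g} {x} {y} {w} {pos} {pos′} P Q = record { pos-suc = pos-suc′ ; block = block′ }
  where
  pos-suc′ : ∀ k → pos (pos′ (suc k)) ≡ pos (pos′ k) + length (concatMap f (g (w k)))
  pos-suc′ k = begin
    pos (pos′ (suc k))                                          ≡⟨ cong pos (pos-suc Q k) ⟩
    pos (pos′ k + length (g (w k)))                             ≡⟨ pos-+ P (pos′ k) (length (g (w k))) ⟩
    pos (pos′ k) + length (concatMap f (slice y (pos′ k) (length (g (w k)))))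
      ≡⟨ cong (λ l → pos (pos′ k) + length (concatMap f l)) (block Q k) ⟩
    pos (pos′ k) + length (concatMap f (g (w k)))               ∎
    where open ≡-Reasoning
  block′ : ∀ k → slice x (pos (pos′ k)) (length (concatMap f (g (w k)))) ≡ concatMap f (g (w k))
  block′ k = subst (λ l → slice x (pos (pos′ k)) (length (concatMap f l)) ≡ concatMap f l) (block Q k)
    (slice-concatMap P (pos′ k) (length (g (w k))))

-- Thue words

pattern c0 = zero
pattern c1 = suc zero
pattern c2 = suc (suc zero)

Not010-212 : List (Fin 3) → Set
Not010-212 u = u ≢ c0 ∷ c1 ∷ c0 ∷ [] × u ≢ c2 ∷ c1 ∷ c2 ∷ []

not010-212? : ∀ u → Dec (Not010-212 u)
not010-212? u = ¬? (≡-dec _≟F_ u _) ×-dec ¬? (≡-dec _≟F_ u _)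

record ThueWord (y : ℕ → Fin 3) : Set where
  field
    squareFree : SquareFree y
    not010-212 : ∀ j → Not010-212 (slice y j 3)
open ThueWord public

ternaryWords : ℕ → List (List (Fin 3))
ternaryWords = walks (allFin 3) (λ _ → allFin 3)

all-ternary-slices : (p : List (Fin 3) → Bool) (y : ℕ → Fin 3) →
  ∀ n → T (all p (ternaryWords n)) → ∀ j → T (p (slice y j (suc n)))
all-ternary-slices p y = all-slices (allFin 3) (λ _ → allFin 3) p (λ i → ∈-allFin (y i)) (λ i → ∈-allFin (y (suc i)))

-- An occurrence of 010 or 212 is ruled out using one letter of context on each side, which
-- the first letter of y lacks.
ThueWord-tail : {B : Set} (_≟B_ : DecidableEquality B) (g : Fin 3 → List B) →
  (∀ a → 0 < length (g a)) →
  T (all (λ w → isYes (not010-212? (take 3 (drop 1 w))) ∨ hasSquare _≟B_ (concatMap g w)) (ternaryWords 4)) →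
  ∀ {x y pos} → Parse g x y pos → SquareFree x → ThueWord (y ∘ suc)
ThueWord-tail _≟B_ g nonempty check {y = y} {pos} P sqx = record
  { squareFree = λ j n 0<n eq → sqy (suc j) n 0<n (trans (sym (slice-suc y j n)) (trans eq (slice-suc y (j + n) n)))
  ; not010-212 = λ j → subst Not010-212 (sym (slice-suc y j 3)) (middle j)
  }
  where
  sqy = squareFree-preimage P nonempty sqx
  middle : ∀ j → Not010-212 (slice y (suc j) 3)
  middle j with Equivalence.to T-∨ (all-ternary-slices
                  (λ w → isYes (not010-212? (take 3 (drop 1 w))) ∨ hasSquare _≟B_ (concatMap g w)) y 4 check j)
  ... | inj₁ allowed = toWitness allowed
  ... | inj₂ square = ⊥-elim (squareFree⇒¬HasSquare sqx (pos j) _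
          (subst HasSquare (sym (slice-concatMap P j 5)) (hasSquare-sound _≟B_ _ square)))

h3-nonempty : ∀ a → 0 < length (h3 a)
h3-nonempty c0 = s≤s z≤n
h3-nonempty c1 = s≤s z≤n
h3-nonempty c2 = s≤s z≤n

h3-length≤3 : ∀ a → length (h3 a) ≤ 3
h3-length≤3 c0 = ≤-refl
h3-length≤3 c1 = s≤s (s≤s z≤n)
h3-length≤3 c2 = s≤s z≤n

module _ {y : ℕ → Fin 3} (thue : ThueWord y) where

  adjacent-distinct : ∀ j → y j ≢ y (suc j)
  adjacent-distinct j eq = squareFree thue j 1 (s≤s z≤n)
    (trans (cong (_∷ []) eq) (cong (λ i → slice y i 1) (+-comm 1 j)))

  zero-within-4 : ∃[ i ] i < 4 × y (0 + i) ≡ c0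
  zero-within-4
    with Equivalence.to T-∨ (all-ternary-slices (λ w → hasSquare _≟F_ w ∨ isYes (DecMembership._∈?_ _≟F_ c0 w)) y 3 _ 0)
  ... | inj₁ square = ⊥-elim (squareFree⇒¬HasSquare (squareFree thue) 0 4 (hasSquare-sound _≟F_ _ square))
  ... | inj₂ c0∈ = ∈-slice y 0 4 (toWitness c0∈)

  -- Blocks of h3 are 012, 02 and 1; the block 1 always follows a block ending in 2.
  H3BlockStart : ℕ → Set
  H3BlockStart p = y p ≡ c0 ⊎ ∃[ q ] p ≡ suc q × y q ≡ c2 × y p ≡ c1

  private
    after-2 : ∀ q → y q ≡ c2 → H3BlockStart (suc q)
    after-2 q e with y (suc q) in e₁
    ... | c0 = inj₁ refl
    ... | c1 = inj₂ (q , refl , e , refl)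
    ... | c2 = ⊥-elim (adjacent-distinct q (trans e (sym e₁)))

    after-21 : ∀ q → y q ≡ c2 → y (suc q) ≡ c1 → H3BlockStart (suc (suc q))
    after-21 q e e₁ with y (suc (suc q)) in e₂
    ... | c0 = inj₁ refl
    ... | c1 = ⊥-elim (adjacent-distinct (suc q) (trans e₁ (sym e₂)))
    ... | c2 = ⊥-elim (proj₂ (not010-212 thue q) (cong₂ _∷_ e (cong₂ _∷_ e₁ (cong (_∷ []) e₂))))

  h3-block-at : ∀ p → H3BlockStart p →
    Σ (Fin 3) λ a → slice y p (length (h3 a)) ≡ h3 a × H3BlockStart (p + length (h3 a))
  h3-block-at p (inj₁ e) with y (suc p) in e₁
  ... | c0 = ⊥-elim (adjacent-distinct p (trans e (sym e₁)))
  ... | c2 = c1 , cong₂ _∷_ e (cong (_∷ []) e₁) , subst H3BlockStart (+-comm 2 p) (after-2 (suc p) e₁)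
  ... | c1 with y (suc (suc p)) in e₂
  ...   | c0 = ⊥-elim (proj₁ (not010-212 thue p) (cong₂ _∷_ e (cong₂ _∷_ e₁ (cong (_∷ []) e₂))))
  ...   | c1 = ⊥-elim (adjacent-distinct (suc p) (trans e₁ (sym e₂)))
  ...   | c2 = c0 , cong₂ _∷_ e (cong₂ _∷_ e₁ (cong (_∷ []) e₂)) ,
                subst H3BlockStart (+-comm 3 p) (after-2 (suc (suc p)) e₂)
  h3-block-at .(suc q) (inj₂ (q , refl , e , e₁)) =
    c2 , cong (_∷ []) e₁ , subst H3BlockStart (+-comm 1 (suc q)) (after-21 q e e₁)

  ThueWord-desubstitute : Σ (ℕ → Fin 3) λ y′ → Σ (ℕ → ℕ) λ pos → Parse h3 y y′ pos × pos 0 ≤ 6 × ThueWord y′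
  ThueWord-desubstitute =
    y′ ∘ suc , pos ∘ suc , Parse-tail P , pos1≤6 , ThueWord-tail _≟F_ h3 h3-nonempty _ P (squareFree thue)
    where
    firstZero = zero-within-4
    unfolded = Parse-unfold h3 y H3BlockStart h3-block-at (proj₁ firstZero) (inj₁ (proj₂ (proj₂ firstZero)))
    y′ = proj₁ unfolded
    pos = proj₁ (proj₂ unfolded)
    P = proj₁ (proj₂ (proj₂ unfolded))
    pos1≤6 : pos 1 ≤ 6
    pos1≤6 = begin
      pos 1                      ≡⟨ pos-suc P 0 ⟩
      pos 0 + length (h3 (y′ 0)) ≡⟨ cong (_+ length (h3 (y′ 0))) (proj₂ (proj₂ (proj₂ unfolded))) ⟩
      proj₁ firstZero + length (h3 (y′ 0))
        ≤⟨ +-mono-≤ (≤-pred (proj₁ (proj₂ firstZero))) (h3-length≤3 (y′ 0)) ⟩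
      6                          ∎
      where open ≤-Reasoning

ThueWord-∋-h3-iter : ∀ {y} → ThueWord y → ∀ n → ∃[ j ] slice y j (length (h3-iter n)) ≡ h3-iter n
ThueWord-∋-h3-iter thue zero = let i , _ , e = zero-within-4 thue in i , cong (_∷ []) e
ThueWord-∋-h3-iter thue (suc n) =
  let _ , pos , P , _ , thue′ = ThueWord-desubstitute thue
      j , e = ThueWord-∋-h3-iter thue′ n
  in pos j , subst (λ w → slice _ (pos j) (length (concatMap h3 w)) ≡ concatMap h3 w) e
                   (slice-concatMap P j (length (h3-iter n)))

-- Factors of the Hall–Thue word

HallThueFactor : List (Fin 3) → Set
HallThueFactor w = ∃[ k ] IsFactorOfList w (h3-iter k)

HallThueFactor-h3 : ∀ {w} → HallThueFactor w → HallThueFactor (concatMap h3 w)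
HallThueFactor-h3 (k , factor) = suc k , factor-concatMap h3 factor

HallThueFactor-infix : ∀ {u w} → IsFactorOfList u w → HallThueFactor w → HallThueFactor u
HallThueFactor-infix u⊑w (k , w⊑) = k , factor-trans u⊑w w⊑

private
  occurs-at : ∀ i w → take i (h3-iter 3) ++ w ++ drop (i + length w) (h3-iter 3) ≡ h3-iter 3 → HallThueFactor w
  occurs-at i w eq = 3 , take i (h3-iter 3) , drop (i + length w) (h3-iter 3) , eq

HallThueFactor-letter : ∀ a → HallThueFactor (a ∷ [])
HallThueFactor-letter c0 = occurs-at 0 _ refl
HallThueFactor-letter c1 = occurs-at 1 _ refl
HallThueFactor-letter c2 = occurs-at 2 _ refl

HallThueFactor-pair : ∀ {a b} → a ≢ b → HallThueFactor (a ∷ b ∷ [])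
HallThueFactor-pair {c0} {c0} a≢b = ⊥-elim (a≢b refl)
HallThueFactor-pair {c0} {c1} _ = occurs-at 0 _ refl
HallThueFactor-pair {c0} {c2} _ = occurs-at 3 _ refl
HallThueFactor-pair {c1} {c0} _ = occurs-at 5 _ refl
HallThueFactor-pair {c1} {c1} a≢b = ⊥-elim (a≢b refl)
HallThueFactor-pair {c1} {c2} _ = occurs-at 1 _ refl
HallThueFactor-pair {c2} {c0} _ = occurs-at 2 _ refl
HallThueFactor-pair {c2} {c1} _ = occurs-at 4 _ refl
HallThueFactor-pair {c2} {c2} a≢b = ⊥-elim (a≢b refl)

h3²-length≥2 : ∀ a → 2 ≤ length (concatMap h3 (h3 a))
h3²-length≥2 c0 = s≤s (s≤s z≤n)
h3²-length≥2 c1 = s≤s (s≤s z≤n)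
h3²-length≥2 c2 = s≤s (s≤s z≤n)

h3²-length≤6 : ∀ a → length (concatMap h3 (h3 a)) ≤ 6
h3²-length≤6 c0 = ≤-refl
h3²-length≤6 c1 = s≤s (s≤s (s≤s (s≤s z≤n)))
h3²-length≤6 c2 = s≤s (s≤s z≤n)

-- A Thue word may begin with 1021, which is not a factor of b₃; hence the bound J.
EventuallyHallThue : ℕ → Set
EventuallyHallThue m = ∃[ J ] ∀ {y} → ThueWord y → ∀ j → J ≤ j → HallThueFactor (slice y j m)

-- Desubstituting twice gives blocks of length at least 2, so a factor of length m
-- lies in the image of a factor of length about m/2.
EventuallyHallThue-halve : ∀ {m t} → m ≤ suc (t * 2) → EventuallyHallThue (suc t) → EventuallyHallThue m
EventuallyHallThue-halve {m} {t} m≤ (J , far) = 24 + J * 6 , λ thue j J′≤j →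
  let _ , pos , P , pos0≤6 , thue′ = ThueWord-desubstitute thue
      y″ , pos′ , P′ , pos′0≤6 , thue″ = ThueWord-desubstitute thue′
      Q = Parse-∘ P P′
      Q0≤24 : pos (pos′ 0) ≤ 24
      Q0≤24 = begin
        pos (pos′ 0)          ≡⟨ cong pos (+-identityʳ (pos′ 0)) ⟨
        pos (pos′ 0 + 0)      ≤⟨ pos-upper P h3-length≤3 (pos′ 0) 0 ⟩
        pos′ 0 * 3 + pos 0    ≤⟨ +-mono-≤ (*-monoˡ-≤ 3 pos′0≤6) pos0≤6 ⟩
        24                    ∎
      k , J≤k , factor = slice-in-image Q (s≤s z≤n) h3²-length≥2 h3²-length≤6 J j m t
                           (≤-trans (+-monoˡ-≤ (J * 6) Q0≤24) J′≤j) m≤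
      image = HallThueFactor-h3 (HallThueFactor-h3 (far thue″ k J≤k))
  in HallThueFactor-infix factor (subst HallThueFactor (sym (concatMap-∘ h3 h3 (slice y″ k (suc t)))) image)
  where open ≤-Reasoning

n≤1+⌊n/2⌋*2 : ∀ n → n ≤ suc (⌊ n /2⌋ * 2)
n≤1+⌊n/2⌋*2 zero = z≤n
n≤1+⌊n/2⌋*2 (suc zero) = ≤-refl
n≤1+⌊n/2⌋*2 (suc (suc n)) = s≤s (s≤s (n≤1+⌊n/2⌋*2 n))

eventuallyHallThue : ∀ m → EventuallyHallThue m
eventuallyHallThue = <-rec EventuallyHallThue λ where
  zero _ → 0 , λ _ _ _ → 0 , [] , c0 ∷ [] , refl
  (suc zero) _ → 0 , λ {y} _ j _ → HallThueFactor-letter (y j)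
  (suc (suc zero)) _ → 0 , λ thue j _ → HallThueFactor-pair (adjacent-distinct thue j)
  m@(suc (suc (suc n))) shorter →
    EventuallyHallThue-halve (n≤1+⌊n/2⌋*2 m) (shorter {suc ⌊ m /2⌋} (s≤s (s≤s (⌊n/2⌋<n n))))

h3-iter-extends : ∀ n → ∃[ r ] 0 < length r × h3-iter (suc n) ≡ h3-iter n ++ r
h3-iter-extends zero = c1 ∷ c2 ∷ [] , s≤s z≤n , refl
h3-iter-extends (suc n) with h3-iter-extends n
... | a ∷ r , _ , eq = concatMap h3 (a ∷ r) ,
  ≤-trans (h3-nonempty a) (subst (length (h3 a) ≤_) (sym (length-++ (h3 a))) (m≤m+n _ _)) ,
  trans (cong (concatMap h3) eq) (concatMap-++ h3 (h3-iter n) (a ∷ r))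

n<length-h3-iter : ∀ n → n < length (h3-iter n)
n<length-h3-iter zero = s≤s z≤n
n<length-h3-iter (suc n) with h3-iter-extends n
... | r , 0<|r| , eq = begin
  suc (suc n)                          ≡⟨ +-comm 1 (suc n) ⟩
  suc n + 1                            ≤⟨ +-mono-≤ (n<length-h3-iter n) 0<|r| ⟩
  length (h3-iter n) + length r        ≡⟨ length-++ (h3-iter n) ⟨
  length (h3-iter n ++ r)              ≡⟨ cong length eq ⟨
  length (h3-iter (suc n))             ∎
  where open ≤-Reasoning

h3-iter-prefix : ∀ a d → ∃[ r ] h3-iter (a + d) ≡ h3-iter a ++ r
h3-iter-prefix a zero = [] , trans (cong h3-iter (+-identityʳ a)) (sym (++-identityʳ (h3-iter a)))
h3-iter-prefix a (suc d) with h3-iter-prefix a d | h3-iter-extends (a + d)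
... | r , eq | r′ , _ , eq′ = r ++ r′ , (begin
  h3-iter (a + suc d)         ≡⟨ cong h3-iter (+-suc a d) ⟩
  h3-iter (suc (a + d))       ≡⟨ eq′ ⟩
  h3-iter (a + d) ++ r′       ≡⟨ cong (_++ r′) eq ⟩
  (h3-iter a ++ r) ++ r′      ≡⟨ ++-assoc (h3-iter a) r r′ ⟩
  h3-iter a ++ r ++ r′        ∎)
  where open ≡-Reasoning

nth-++ : (d : A) (u v : List A) (i : ℕ) → i < length u → nth d (u ++ v) i ≡ nth d u i
nth-++ d (a ∷ u) v zero _ = refl
nth-++ d (a ∷ u) v (suc i) (s≤s i<|u|) = nth-++ d u v i i<|u|

b3-nth : ∀ k i → i < length (h3-iter k) → b3 i ≡ nth c0 (h3-iter k) i
b3-nth k i i<|k| with h3-iter-prefix (suc i) k | h3-iter-prefix k (suc i)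
... | r , eq | r′ , eq′ = begin
  nth c0 (h3-iter (suc i)) i
    ≡⟨ nth-++ c0 (h3-iter (suc i)) r i (<-trans (n<1+n i) (n<length-h3-iter (suc i))) ⟨
  nth c0 (h3-iter (suc i) ++ r) i
    ≡⟨ cong (λ w → nth c0 w i) (trans (sym eq) (cong h3-iter (+-comm (suc i) k))) ⟩
  nth c0 (h3-iter (k + suc i)) i           ≡⟨ cong (λ w → nth c0 w i) eq′ ⟩
  nth c0 (h3-iter k ++ r′) i               ≡⟨ nth-++ c0 (h3-iter k) r′ i i<|k| ⟩
  nth c0 (h3-iter k) i                     ∎
  where open ≡-Reasoning

prefix-b3-h3-iter : ∀ k → prefix b3 (length (h3-iter k)) ≡ h3-iter k
prefix-b3-h3-iter k = trans (map-upTo-slice b3 _) (slice-nth b3 c0 0 (h3-iter k) (b3-nth k))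

h3-iter-extends-prefix : ∀ n → ∃[ r ] h3-iter n ≡ prefix b3 n ++ r
h3-iter-extends-prefix n = slice b3 n (L ∸ n) , (begin
  h3-iter n                              ≡⟨ prefix-b3-h3-iter n ⟨
  prefix b3 L                            ≡⟨ map-upTo-slice b3 L ⟩
  slice b3 0 L                           ≡⟨ cong (slice b3 0) (m+[n∸m]≡n (<⇒≤ (n<length-h3-iter n))) ⟨
  slice b3 0 (n + (L ∸ n))               ≡⟨ slice-+ b3 0 n (L ∸ n) ⟩
  slice b3 0 n ++ slice b3 n (L ∸ n)     ≡⟨ cong (_++ slice b3 n (L ∸ n)) (map-upTo-slice b3 n) ⟨
  prefix b3 n ++ slice b3 n (L ∸ n)      ∎)
  where
  open ≡-Reasoning
  L = length (h3-iter n)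

-- Square-free walks on P₅

index : V5 → ℕ
index v2 = 0
index v0 = 1
index v1 = 2
index v2h = 3
index v0h = 4

vertex : ℕ → V5
vertex 0 = v2
vertex 1 = v0
vertex 2 = v1
vertex 3 = v2h
vertex _ = v0h

vertex-index : ∀ a → vertex (index a) ≡ a
vertex-index v2 = refl
vertex-index v0 = refl
vertex-index v1 = refl
vertex-index v2h = refl
vertex-index v0h = refl

_≟V_ : DecidableEquality V5
_≟V_ = eq? (mk↣ λ {a} {b} eq → trans (sym (vertex-index a)) (trans (cong vertex eq) (vertex-index b)))

vertices : List V5
vertices = v2 ∷ v0 ∷ v1 ∷ v2h ∷ v0h ∷ []

∈-vertices : ∀ a → a ∈ vertices
∈-vertices v2 = here refl
∈-vertices v0 = there (here refl)
∈-vertices v1 = there (there (here refl))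
∈-vertices v2h = there (there (there (here refl)))
∈-vertices v0h = there (there (there (there (here refl))))

neighbours : V5 → List V5
neighbours v2 = v0 ∷ []
neighbours v0 = v2 ∷ v1 ∷ []
neighbours v1 = v0 ∷ v2h ∷ []
neighbours v2h = v1 ∷ v0h ∷ []
neighbours v0h = v2h ∷ []

Adj5⇒∈neighbours : ∀ {a b} → Adj5 a b → b ∈ neighbours a
Adj5⇒∈neighbours e20 = here refl
Adj5⇒∈neighbours e02 = here refl
Adj5⇒∈neighbours e01 = there (here refl)
Adj5⇒∈neighbours e10 = here refl
Adj5⇒∈neighbours e12h = there (here refl)
Adj5⇒∈neighbours e2h1 = here refl
Adj5⇒∈neighbours e2h0h = there (here refl)
Adj5⇒∈neighbours e0h2h = here refl

IsWalk : (ℕ → V5) → Set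
IsWalk z = ∀ i → Adj5 (z i) (z (suc i))

BlockAfterZero : List V5 → Set
BlockAfterZero (_ ∷ _ ∷ c ∷ w) = c ≡ v0 → ∃[ a ] take (length (k5 a) + 1) (c ∷ w) ≡ k5 a ∷ʳ v0
BlockAfterZero _ = ⊤

blockAfterZero? : Decidable BlockAfterZero
blockAfterZero? [] = yes tt
blockAfterZero? (_ ∷ []) = yes tt
blockAfterZero? (_ ∷ _ ∷ []) = yes tt
blockAfterZero? (_ ∷ _ ∷ c ∷ w) =
  (c ≟V v0) →-dec any? λ a → ≡-dec _≟V_ (take (length (k5 a) + 1) (c ∷ w)) (k5 a ∷ʳ v0)

k5-length≤6 : ∀ a → length (k5 a) ≤ 6
k5-length≤6 zero = ≤-refl
k5-length≤6 (suc zero) = s≤s (s≤s (s≤s (s≤s z≤n)))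
k5-length≤6 (suc (suc zero)) = s≤s (s≤s z≤n)

module _ {z : ℕ → V5} (walk : IsWalk z) (squareFree : SquareFree z) where

  private
    p5-slices : ∀ (p : List V5 → Bool) n → T (all p (walks vertices neighbours n)) → ∀ j → T (p (slice z j (suc n)))
    p5-slices p = all-slices vertices neighbours p (λ i → ∈-vertices (z i)) (λ i → Adj5⇒∈neighbours (walk i))

  -- Opaque because unfolding these proofs re-runs the exhaustive checks inside later
  -- conversion problems.  The two letters before the 0 are needed: with less left context
  -- the block following a 0 is not determined.
  opaque
    k5-block-after-zero : ∀ p → z (2 + p) ≡ v0 →
      Σ (Fin 3) λ a → slice z (2 + p) (length (k5 a)) ≡ k5 a × z (2 + p + length (k5 a)) ≡ v0
    k5-block-after-zero p z≡v0
      with Equivalence.to T-∨ (p5-slices (λ w → hasSquare _≟V_ w ∨ isYes (blockAfterZero? w)) 10 _ p)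
    ... | inj₁ square = ⊥-elim (squareFree⇒¬HasSquare squareFree p 11 (hasSquare-sound _≟V_ _ square))
    ... | inj₂ block with toWitness block z≡v0
    ... | a , eq = a , proj₁ parts , ∷-injectiveˡ (proj₂ parts)
      where
      q : ℕ
      q = 2 + p
      parts : slice z q (length (k5 a)) ≡ k5 a × slice z (q + length (k5 a)) 1 ≡ v0 ∷ []
      parts = ++-cancel-length (slice z q (length (k5 a))) (k5 a) (length-slice z q _) (begin
        slice z q (length (k5 a)) ++ slice z (q + length (k5 a)) 1 ≡⟨ slice-+ z q (length (k5 a)) 1 ⟨
        slice z q (length (k5 a) + 1)
          ≡⟨ take-slice z q (+-monoˡ-≤ 1 (≤-trans (k5-length≤6 a) (m≤m+n 6 2))) ⟨
        take (length (k5 a) + 1) (slice z q 9)                    ≡⟨ eq ⟩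
        k5 a ∷ʳ v0                                                ∎)
        where open ≡-Reasoning

    zero-within-8 : ∀ j → ∃[ i ] i < 8 × z (j + i) ≡ v0
    zero-within-8 j
      with Equivalence.to T-∨ (p5-slices (λ w → hasSquare _≟V_ w ∨ isYes (DecMembership._∈?_ _≟V_ v0 w)) 7 _ j)
    ... | inj₁ square = ⊥-elim (squareFree⇒¬HasSquare squareFree j 8 (hasSquare-sound _≟V_ _ square))
    ... | inj₂ v0∈ = ∈-slice z j 8 (toWitness v0∈)

k5-nonempty : ∀ a → 0 < length (k5 a)
k5-nonempty zero = s≤s z≤n
k5-nonempty (suc zero) = s≤s z≤n
k5-nonempty (suc (suc zero)) = s≤s z≤n

P5-parse : ∀ {z} → IsWalk z → SquareFree z →
  Σ (ℕ → Fin 3) λ y → Σ (ℕ → ℕ) λ pos → Parse k5 z y pos × pos 0 ≤ 15 × ThueWord y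
P5-parse {z} walk squareFree =
  y ∘ suc , pos ∘ suc , Parse-tail P , pos1≤15 , ThueWord-tail _≟V_ k5 k5-nonempty _ P squareFree
  where
  ZeroAt≥2 : ℕ → Set
  ZeroAt≥2 q = ∃[ p ] q ≡ 2 + p × z q ≡ v0
  step : ∀ q → ZeroAt≥2 q → Σ (Fin 3) λ a → slice z q (length (k5 a)) ≡ k5 a × ZeroAt≥2 (q + length (k5 a))
  step .(2 + p) (p , refl , e) =
    let a , blk , e′ = k5-block-after-zero walk squareFree p e in a , blk , p + length (k5 a) , refl , e′
  firstZero = zero-within-8 walk squareFree 2
  i = proj₁ firstZero
  unfolded = Parse-unfold k5 z ZeroAt≥2 step (2 + i) (i , refl , proj₂ (proj₂ firstZero))
  y = proj₁ unfolded
  pos = proj₁ (proj₂ unfolded)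
  P = proj₁ (proj₂ (proj₂ unfolded))
  pos1≤15 : pos 1 ≤ 15
  pos1≤15 = begin
    pos 1                          ≡⟨ pos-suc P 0 ⟩
    pos 0 + length (k5 (y 0))      ≡⟨ cong (_+ length (k5 (y 0))) (proj₂ (proj₂ (proj₂ unfolded))) ⟩
    2 + i + length (k5 (y 0))
      ≤⟨ +-mono-≤ (+-monoʳ-≤ 2 (≤-pred (proj₁ (proj₂ firstZero)))) (k5-length≤6 (y 0)) ⟩
    15                             ∎
    where open ≤-Reasoning

HallThueFactor⇒IsFactorOfImage : ∀ {u w} → IsFactorOfList u (concatMap k5 w) → HallThueFactor w →
  IsFactorOfImage u k5 b3
HallThueFactor⇒IsFactorOfImage u⊑ (k , w⊑) = length (h3-iter k) ,
  factor-trans u⊑ (subst (IsFactorOfList _) (cong (concatMap k5) (sym (prefix-b3-h3-iter k))) (factor-concatMap k5 w⊑))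

-- Bi-infinite walks

module _ (x : ℤ → V5) (walk : IsWalkBi x) (squareFree : SquareFreeBi x) where

  from : ℤ → ℕ → V5
  from b k = x (b +ℤ ℤ.+ k)

  private
    +-shift : ∀ b j t → b +ℤ ℤ.+ j +ℤ ℤ.+ t ≡ b +ℤ ℤ.+ (j + t)
    +-shift b j t = trans (ℤ.+-assoc b (ℤ.+ j) (ℤ.+ t)) (cong (b +ℤ_) (sym (ℤ.pos-+ j t)))

  window-from : ∀ b j n → window x (b +ℤ ℤ.+ j) n ≡ slice (from b) j n
  window-from b j n = trans (map-upTo-slice _ n) (slice-cong n λ t → cong x (+-shift b j t))

  from-walk : ∀ b → IsWalk (from b)
  from-walk b k = subst (λ q → Adj5 (from b k) (x q))
    (trans (+-shift b k 1) (cong (λ q → b +ℤ ℤ.+ q) (+-comm k 1))) (walk (b +ℤ ℤ.+ k))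

  from-squareFree : ∀ b → SquareFree (from b)
  from-squareFree b j n 0<n eq = squareFree (b +ℤ ℤ.+ j) n 0<n (begin
    window x (b +ℤ ℤ.+ j) n              ≡⟨ window-from b j n ⟩
    slice (from b) j n                  ≡⟨ eq ⟩
    slice (from b) (j + n) n            ≡⟨ window-from b (j + n) n ⟨
    window x (b +ℤ ℤ.+ (j + n)) n        ≡⟨ cong (λ q → window x q n) (+-shift b j n) ⟨
    window x (b +ℤ ℤ.+ j +ℤ ℤ.+ n) n      ∎)
    where open ≡-Reasoning

  slice-factor⇒IsFactorBi : ∀ {u} b j n → IsFactorOfList u (slice (from b) j n) → IsFactorBi u x
  slice-factor⇒IsFactorBi {u} b j n (p , s , eq) =
    b +ℤ ℤ.+ (j + length p) , trans (window-from b _ (length u)) (slice-infix (from b) j n p u s (sym eq))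

  image⇒factor : ∀ u → IsFactorOfImage u k5 b3 → IsFactorBi u x
  image⇒factor u (n , u⊑) =
    let y , pos , P , _ , thue = P5-parse (from-walk 0ℤ) (from-squareFree 0ℤ)
        j , occurs = ThueWord-∋-h3-iter thue n
        r , extends = h3-iter-extends-prefix n
        W = slice y j (length (h3-iter n))
        image≡ : slice (from 0ℤ) (pos j) (length (concatMap k5 W)) ≡ concatMap k5 (h3-iter n)
        image≡ = trans (slice-concatMap P j (length (h3-iter n))) (cong (concatMap k5) occurs)
        u⊑image : IsFactorOfList u (concatMap k5 (h3-iter n))
        u⊑image = factor-trans u⊑ (factor-concatMap k5 ([] , r , sym extends))
    in slice-factor⇒IsFactorBi 0ℤ (pos j) (length (concatMap k5 W)) (subst (IsFactorOfList u) (sym image≡) u⊑image)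

  factor⇒image : ∀ u → IsFactorBi u x → IsFactorOfImage u k5 b3
  factor⇒image u (i , eq) =
    let m = length u
        J , far = eventuallyHallThue (suc m)
        d = 15 + J * 6
        b = i - ℤ.+ d
        y , _ , P , pos0≤15 , thue = P5-parse (from-walk b) (from-squareFree b)
        k , J≤k , slice⊑ = slice-in-image P (s≤s z≤n) k5-nonempty k5-length≤6 J d m m
                             (+-monoˡ-≤ (J * 6) pos0≤15) (subst (λ t → m ≤ suc t) (sym (*-identityʳ m)) (n≤1+n m))
        b+d≡i : b +ℤ ℤ.+ d ≡ i
        b+d≡i = trans (ℤ.+-assoc i (- ℤ.+ d) (ℤ.+ d))
                  (trans (cong (i +ℤ_) (ℤ.+-inverseˡ (ℤ.+ d))) (ℤ.+-identityʳ i))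
        slice≡u : slice (from b) d m ≡ u
        slice≡u = trans (sym (window-from b d m)) (trans (cong (λ q → window x q m) b+d≡i) eq)
    in HallThueFactor⇒IsFactorOfImage (subst (λ v → IsFactorOfList v (concatMap k5 (slice y k (suc m)))) slice≡u slice⊑)
         (far thue k J≤k)

theorem5 : (x : ℤ → V5) → IsWalkBi x → SquareFreeBi x →
    (u : List V5) → IsFactorBi u x ⇔ IsFactorOfImage u k5 b3
theorem5 x walk squareFree u = mk⇔ (factor⇒image x walk squareFree u) (image⇒factor x walk squareFree u)
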